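{- Let $\Gamma$ be a connected framed four-valent graph. Then the following are equivalent: (i) $\Gamma$ admits a source-target structure; (ii) $\Gamma$ admits a checkerboard-colourable embedding into an orientable closed surface; (iii) for every rotating circuit of $\Gamma$, all chords of the corresponding framed chord diagram are positive.
   Context: A framed four-valent graph is a finite 4-valent graph (loops and multiple edges allowed) in which, at each vertex, the four half-edges are partitioned into two pairs of "opposite" half-edges. A source-target structure on $\Gamma$ is an orientation of every edge such that at each vertex the two half-edges of one opposite pair are outgoing and the two half-edges of the other opposite pair are incoming. A checkerboard-colourable embedding of $\Gamma$ is a cellular embedding of $\Gamma$ into a closed surface $S$ (every component of $S\setminus\Gamma$ is an open disc) such that at every vertex the two half-edges of each opposite pair are not cyclically adjacent in the local rotation, and such that the faces can be coloured black and white with faces on the two sides of every edge having different colours. A rotating circuit of $\Gamma$ is a closed walk, given as a map from an oriented circle $S^1$ to $\Gamma$, traversing every edge exactly once and passing through every vertex exactly twice, such that at each passage through a vertex it enters along one half-edge and leaves along a half-edge not opposite to it. Its framed chord diagram consists of the oriented circle $S^1$ with, for each vertex $v$, a chord joining the two preimages of $v$; this chord is positive if the two half-edges along which the circuit (with its orientation) enters $v$ are opposite to each other, and negative otherwise. -}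

module Defs where

open import Data.Nat using (ℕ; zero; suc; _*_; _<_)
open import Data.Nat.DivMod using (_%_; m%n<n)
open import Data.Fin using (Fin; toℕ; fromℕ<) renaming (zero to f0; suc to fs)
open import Data.Bool using (Bool; true; false; not)
open import Data.Product using (Σ; ∃; _×_; _,_; proj₁; proj₂)
open import Data.Sum using (_⊎_; inj₁; inj₂; [_,_])
open import Relation.Binary.PropositionalEquality using (_≡_; _≢_)
open import Function.Definitions using (Injective)

-- Each vertex v carries four half-edges (v , i),
-- i : Fin 4.  The framing (partition into opposite pairs) is the fixed
-- one {0,2} , {1,3}; every framed 4-valent graph is isomorphic to one
-- presented this way.  Edges are given by a fixed-point-free involution
-- on half-edges (this allows loops and multiple edges).

HalfEdge : ℕ → Set
HalfEdge n = Fin n × Fin 4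

opp : Fin 4 → Fin 4
opp f0 = fs (fs f0)
opp (fs f0) = fs (fs (fs f0))
opp (fs (fs f0)) = f0
opp (fs (fs (fs f0))) = fs f0

record FramedGraph (n : ℕ) : Set where
  field
    ι     : HalfEdge n → HalfEdge n
    invol : ∀ h → ι (ι h) ≡ h
    noFix : ∀ h → ι h ≢ h
open FramedGraph public

vtx : ∀ {n} → HalfEdge n → Fin n
vtx = proj₁

slot : ∀ {n} → HalfEdge n → Fin 4
slot = proj₂

data Reach {n} (Γ : FramedGraph n) : Fin n → Fin n → Set where
  here : ∀ {u} → Reach Γ u u
  step : ∀ {u v} (i : Fin 4) → Reach Γ (vtx (ι Γ (u , i))) v → Reach Γ u v

Connected : ∀ {n} → FramedGraph n → Set
Connected {n} Γ = (0 < n) × (∀ u v → Reach Γ u v)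

-- (i) source-target structures.
-- out h ≡ true means: the edge containing h is oriented away from h.

SourceTarget : ∀ {n} → FramedGraph n → Set
SourceTarget {n} Γ =
  Σ (HalfEdge n → Bool) λ out →
    (∀ h → out (ι Γ h) ≡ not (out h)) ×
    (∀ v → (out (v , f0) ≡ true × out (v , fs (fs f0)) ≡ true ×
            out (v , fs f0) ≡ false × out (v , fs (fs (fs f0))) ≡ false)
         ⊎ (out (v , f0) ≡ false × out (v , fs (fs f0)) ≡ false ×
            out (v , fs f0) ≡ true × out (v , fs (fs (fs f0))) ≡ true))

-- (ii) checkerboard-colourable cellular embeddings into orientable
-- closed surfaces, presented combinatorially as rotation systems
-- (Heffter–Edmonds): at each vertex a cyclic order (a 4-cycle) of the
-- four half-edges; faces are the orbits of the face permutation.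

Is4Cycle : (Fin 4 → Fin 4) → Set
Is4Cycle σ = Injective _≡_ _≡_ σ × (∀ i → σ i ≢ i) × (∀ i → σ (σ i) ≢ i)

faceStep : ∀ {n} → FramedGraph n → (Fin n → Fin 4 → Fin 4) →
           HalfEdge n → HalfEdge n
faceStep Γ rot h = vtx (ι Γ h) , rot (vtx (ι Γ h)) (slot (ι Γ h))

record CheckerboardEmbedding {n} (Γ : FramedGraph n) : Set where
  field
    rot        : Fin n → Fin 4 → Fin 4
    rot-cyclic : ∀ v → Is4Cycle (rot v)
    rot-opp    : ∀ v i → rot v i ≢ opp i
    -- colouring of faces (a colour on half-edges constant on face orbits)
    colour      : HalfEdge n → Bool
    colour-face : ∀ h → colour (faceStep Γ rot h) ≡ colour h
    -- the two sides of the edge {h , ι h} get different colours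
    colour-edge : ∀ h → colour (ι Γ h) ≢ colour h

next : ∀ {L} → Fin L → Fin L
next {suc L} i = fromℕ< (m%n<n (suc (toℕ i)) (suc L))

-- A rotating circuit with 2n edge-traversals (a 4-valent graph on n
-- vertices has 2n edges).  dep k is the half-edge along which the walk
-- leaves a vertex on its k-th edge; arr k = ι (dep k) is the half-edge
-- along which it enters the next vertex (passage k).
record RotatingCircuit {n} (Γ : FramedGraph n) : Set where
  field
    dep : Fin (2 * n) → HalfEdge n
  arr : Fin (2 * n) → HalfEdge n
  arr k = ι Γ (dep k)
  field
    cont    : ∀ k → vtx (dep (next k)) ≡ vtx (arr k)
    turn    : ∀ k → slot (dep (next k)) ≢ opp (slot (arr k))
    once    : Injective _≡_ _≡_ [ dep , arr ]
    covers  : ∀ h → Σ (Fin (2 * n) ⊎ Fin (2 * n)) λ x → [ dep , arr ] x ≡ h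

-- The chord at vertex v joins the two passages k ≢ l through v; it is
-- positive iff the two entering half-edges arr k, arr l are opposite.
AllChordsPositive : ∀ {n} {Γ : FramedGraph n} → RotatingCircuit Γ → Set
AllChordsPositive {n} C =
  ∀ (k l : Fin (2 * n)) → k ≢ l → vtx (arr k) ≡ vtx (arr l) →
    slot (arr l) ≡ opp (slot (arr k))
  where open RotatingCircuit C

-- Everything happens at the vertices: (i) asks for an orientation whose four half-edges at
-- each vertex agree on opposite pairs and differ on adjacent ones, and (ii) and (iii) both
-- produce and consume exactly such "alternating" labellings.
-- (i) ⇔ (ii): for the rotation stepping to an adjacent slot, colouring faces like the
-- outgoing/incoming half-edges is a checkerboard colouring; conversely an admissible rotation
-- squares to the opposite map, so face colours alternate around every vertex.
-- (i) ⇒ (iii): a rotating circuit always turns into an adjacent half-edge, so it keeps the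
-- direction of the source-target structure, and its two arrivals at a vertex, being incoming,
-- are opposite.
-- (iii) ⇒ (i): orient each edge as a rotating circuit traverses it; positivity makes the two
-- arrivals at each vertex opposite. Such a circuit exists in a connected graph: choose at every vertex one of the two non-opposite pairings of its
-- half-edges and follow the resulting closed walk; while it misses half-edges, connectivity
-- gives a vertex where it meets some and misses others, and switching the pairing there
-- splices in a second closed walk, so the walk grows until it covers the graph.

module Submission where

open import Defs
open import Data.Bool using (Bool; true; false; not)
open import Data.Bool.Properties using (not-involutive; not-¬; ¬-not)
open import Data.Empty using (⊥-elim)
open import Data.Fin using (Fin; Fin′; zero; suc; toℕ; fromℕ; fromℕ<; inject; inject₁; splitAt; join; _≟_)
open import Data.Fin.Induction using (<-weakInduction)
open import Data.Fin.Patterns using (0F; 1F; 2F; 3F)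
open import Data.Fin.Properties
  using (all?; any?; ¬∀⟶∃¬; ¬∀⟶∃¬-smallest; pigeonhole; injective⇒≤; *↔×; join-splitAt; splitAt-join;
         toℕ-injective; toℕ<n; toℕ-fromℕ; toℕ-fromℕ<; toℕ-inject; toℕ-inject₁)
open import Data.Nat using (ℕ; zero; suc; _+_; _*_; _∸_; _<_; _≤_; z≤n; s≤s; NonZero; _≤?_)
open import Data.Nat.DivMod using (_%_; _/_; m≡m%n+[m/n]*n; m<n⇒m%n≡m; n%n≡0; m%n<n)
open import Data.Nat.Properties
  using (+-comm; +-suc; +-identityʳ; *-comm; *-assoc; *-suc; *-cancelˡ-≡; +-cancelˡ-≤; +-cancelˡ-<;
         +-monoˡ-≤; m∸n+n≡m; m+[n∸m]≡n; m∸n≤m; m<n⇒0<n∸m; m<m+n; m≤n+m; n<1+n; n≮0;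
         m<n⇒m<1+n; m<1+n⇒m≤n; <⇒≤; ≰⇒>; <-cmp; <-irrefl; ≤-refl; ≤-reflexive; ≤-trans; ≤-antisym;
         ≤-<-trans; <-≤-trans)
open import Data.Product using (Σ; ∃; _×_; _,_; proj₁; proj₂)
open import Data.Product.Properties using (×-≡,≡→≡)
open import Data.Sum using (_⊎_; inj₁; inj₂; [_,_])
open import Function.Base using (const; _∘_)
open import Function.Bundles using (_↔_; Inverse; _⇔_; mk⇔)
open import Function.Definitions using (Injective)
open import Relation.Binary.Definitions using (DecidableEquality; tri<; tri≈; tri>)
open import Relation.Binary.PropositionalEquality hiding ([_])
open import Relation.Nullary using (¬_; Dec; yes; no; ¬?)
open import Relation.Nullary.Decidable using (from-yes; map′; decidable-stable; _⊎-dec_; _→-dec_)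

open ≡-Reasoning

-- Slots at a vertex

≡not-sym : ∀ {x y} → x ≡ not y → y ≡ not x
≡not-sym {x} {y} x≡¬y = trans (sym (not-involutive y)) (cong not (sym x≡¬y))

succ₄ : Fin 4 → Fin 4
succ₄ 0F = 1F
succ₄ 1F = 2F
succ₄ 2F = 3F
succ₄ 3F = 0F

slot-cases : ∀ i j → j ≡ i ⊎ j ≡ opp i ⊎ j ≡ succ₄ i ⊎ i ≡ succ₄ j
slot-cases = from-yes (all? λ i → all? λ j →
  j ≟ i ⊎-dec j ≟ opp i ⊎-dec j ≟ succ₄ i ⊎-dec i ≟ succ₄ j)

opp-involutive : ∀ i → opp (opp i) ≡ i
opp-involutive = from-yes (all? λ i → opp (opp i) ≟ i)

succ₄-succ₄ : ∀ i → succ₄ (succ₄ i) ≡ opp i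
succ₄-succ₄ = from-yes (all? λ i → succ₄ (succ₄ i) ≟ opp i)

succ₄-injective : Injective _≡_ _≡_ succ₄
succ₄-injective {i} {j} = from-yes (all? λ i → all? λ j → succ₄ i ≟ succ₄ j →-dec i ≟ j) i j

succ₄-is4Cycle : Is4Cycle succ₄
succ₄-is4Cycle = succ₄-injective
               , from-yes (all? λ i → ¬? (succ₄ i ≟ i))
               , from-yes (all? λ i → ¬? (succ₄ (succ₄ i) ≟ i))

succ₄-not-opposite : ∀ i → succ₄ i ≢ opp i
succ₄-not-opposite = from-yes (all? λ i → ¬? (succ₄ i ≟ opp i))

neighbour : ∀ {i j} → j ≢ i → j ≢ opp i → j ≡ succ₄ i ⊎ i ≡ succ₄ j
neighbour {i} {j} j≢i j≢opp with slot-cases i j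
... | inj₁ j≡i               = ⊥-elim (j≢i j≡i)
... | inj₂ (inj₁ j≡opp)      = ⊥-elim (j≢opp j≡opp)
... | inj₂ (inj₂ j-adjacent) = j-adjacent

square-opposite : ∀ {σ : Fin 4 → Fin 4} → (∀ i → σ i ≢ i) → (∀ i → σ (σ i) ≢ i) →
                  (∀ i → σ i ≢ opp i) → ∀ i → σ (σ i) ≡ opp i
square-opposite {σ} fix fix² avoid i
  with neighbour (fix i) (avoid i) | neighbour (fix (σ i)) (avoid (σ i))
... | inj₁ σi≡ | inj₁ σσi≡ = trans σσi≡ (trans (cong succ₄ σi≡) (succ₄-succ₄ i))
... | inj₁ σi≡ | inj₂ σi≡′ = ⊥-elim (fix² i (sym (succ₄-injective (trans (sym σi≡) σi≡′))))
... | inj₂ i≡  | inj₁ σσi≡ = ⊥-elim (fix² i (trans σσi≡ (sym i≡)))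
... | inj₂ i≡  | inj₂ σi≡  = begin
  σ (σ i)                          ≡⟨ opp-involutive _ ⟨
  opp (opp (σ (σ i)))              ≡⟨ cong opp (succ₄-succ₄ _) ⟨
  opp (succ₄ (succ₄ (σ (σ i))))    ≡⟨ cong opp (trans i≡ (cong succ₄ σi≡)) ⟨
  opp i                            ∎

_at_ : ∀ {n} {A : Set} → (HalfEdge n → A) → Fin n → Fin 4 → A
(g at v) i = g (v , i)

Alternating : (Fin 4 → Bool) → Set
Alternating f = (f 0F ≡ true  × f 2F ≡ true  × f 1F ≡ false × f 3F ≡ false)
              ⊎ (f 0F ≡ false × f 2F ≡ false × f 1F ≡ true  × f 3F ≡ true)

alternating-intro : ∀ f → f 1F ≡ not (f 0F) → f 2F ≡ f 0F → f 3F ≡ f 1F → Alternating f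
alternating-intro f f1 f2 f3 with f 0F
... | true  = inj₁ (refl , f2 , f1 , trans f3 f1)
... | false = inj₂ (refl , f2 , f1 , trans f3 f1)

alternating⇒flips : ∀ f → Alternating f → ∀ i → f (succ₄ i) ≡ not (f i)
alternating⇒flips f (inj₁ (f0 , f2 , f1 , f3)) 0F = trans f1 (cong not (sym f0))
alternating⇒flips f (inj₁ (f0 , f2 , f1 , f3)) 1F = trans f2 (cong not (sym f1))
alternating⇒flips f (inj₁ (f0 , f2 , f1 , f3)) 2F = trans f3 (cong not (sym f2))
alternating⇒flips f (inj₁ (f0 , f2 , f1 , f3)) 3F = trans f0 (cong not (sym f3))
alternating⇒flips f (inj₂ (f0 , f2 , f1 , f3)) 0F = trans f1 (cong not (sym f0))
alternating⇒flips f (inj₂ (f0 , f2 , f1 , f3)) 1F = trans f2 (cong not (sym f1))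
alternating⇒flips f (inj₂ (f0 , f2 , f1 , f3)) 2F = trans f3 (cong not (sym f2))
alternating⇒flips f (inj₂ (f0 , f2 , f1 , f3)) 3F = trans f0 (cong not (sym f3))

alternating-neighbour : ∀ f → Alternating f → ∀ {i j} → j ≢ i → j ≢ opp i → f j ≡ not (f i)
alternating-neighbour f alt {i} j≢i j≢opp with neighbour j≢i j≢opp
... | inj₁ refl = alternating⇒flips f alt i
... | inj₂ refl = ≡not-sym (alternating⇒flips f alt _)

alternating-equal⇒opposite : ∀ f → Alternating f → ∀ {i j} → j ≢ i → f j ≡ f i → j ≡ opp i
alternating-equal⇒opposite f alt {i} {j} j≢i fj≡fi with j ≟ opp i
... | yes j≡opp = j≡opp
... | no  j≢opp = ⊥-elim (not-¬ fj≡fi (alternating-neighbour f alt j≢i j≢opp))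

opposite-invariant⇒alternating : ∀ f → (∀ i → f (opp i) ≡ f i) →
                                 ∀ {i j} → f j ≡ not (f i) → Alternating f
opposite-invariant⇒alternating f opp-inv {i} {j} fj≡¬fi =
  alternating-intro f (¬-not f1≢f0) (opp-inv 0F) (opp-inv 1F)
  where
  constant : f 1F ≡ f 0F → ∀ k → f k ≡ f 0F
  constant f1≡f0 0F = refl
  constant f1≡f0 1F = f1≡f0
  constant f1≡f0 2F = opp-inv 0F
  constant f1≡f0 3F = trans (opp-inv 1F) f1≡f0
  f1≢f0 : f 1F ≢ f 0F
  f1≢f0 f1≡f0 = not-¬ refl (trans (trans (constant f1≡f0 i) (sym (constant f1≡f0 j))) fj≡¬fi)

rotation-alternating : ∀ {σ} f → Is4Cycle σ → (∀ i → σ i ≢ opp i) →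
                       (∀ i → f (σ i) ≡ not (f i)) → Alternating f
rotation-alternating {σ} f (_ , fix , fix²) avoid flips =
  opposite-invariant⇒alternating f opp-inv (flips 0F)
  where
  opp-inv : ∀ i → f (opp i) ≡ f i
  opp-inv i = begin
    f (opp i)         ≡⟨ cong f (square-opposite fix fix² avoid i) ⟨
    f (σ (σ i))       ≡⟨ flips (σ i) ⟩
    not (f (σ i))     ≡⟨ cong not (flips i) ⟩
    not (not (f i))   ≡⟨ not-involutive (f i) ⟩
    f i               ∎

-- Source-target structures and checkerboard embeddings

module _ {n} {Γ : FramedGraph n} where

  sourceTarget⇒embedding : SourceTarget Γ → CheckerboardEmbedding Γ
  sourceTarget⇒embedding (out , out-ι , alternating) = record
    { rot         = λ _ → succ₄
    ; rot-cyclic  = λ _ → succ₄-is4Cycle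
    ; rot-opp     = λ _ → succ₄-not-opposite
    ; colour      = out
    ; colour-face = face
    ; colour-edge = λ h same → not-¬ same (out-ι h)
    }
    where
    face : ∀ h → out (faceStep Γ (λ _ → succ₄) h) ≡ out h
    face h = trans (alternating⇒flips (out at vtx (ι Γ h)) (alternating (vtx (ι Γ h))) (slot (ι Γ h)))
                   (sym (≡not-sym (out-ι h)))

  embedding⇒sourceTarget : CheckerboardEmbedding Γ → SourceTarget Γ
  embedding⇒sourceTarget E = colour , colour-ι , λ v →
    rotation-alternating (colour at v) (rot-cyclic v) (rot-opp v) (colour-rot v)
    where
    open CheckerboardEmbedding E
    colour-ι : ∀ h → colour (ι Γ h) ≡ not (colour h)
    colour-ι h = ¬-not (colour-edge h)
    colour-rot : ∀ v i → colour (v , rot v i) ≡ not (colour (v , i))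
    colour-rot v i = begin
      colour (v , rot v i)
        ≡⟨ cong (λ h → colour (vtx h , rot (vtx h) (slot h))) (invol Γ (v , i)) ⟨
      colour (faceStep Γ rot (ι Γ (v , i))) ≡⟨ colour-face (ι Γ (v , i)) ⟩
      colour (ι Γ (v , i))                  ≡⟨ colour-ι (v , i) ⟩
      not (colour (v , i))                  ∎

-- Rotating circuits and signs of chords

toℕ-next : ∀ {L} (k : Fin (suc L)) → toℕ (next k) ≡ suc (toℕ k) % suc L
toℕ-next {L} k = toℕ-fromℕ< (m%n<n (suc (toℕ k)) (suc L))

next-inject₁ : ∀ {L} (i : Fin L) → next (inject₁ i) ≡ suc i
next-inject₁ {suc L} i = toℕ-injective (begin
  toℕ (next (inject₁ i))                    ≡⟨ toℕ-next (inject₁ i) ⟩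
  suc (toℕ (inject₁ i)) % suc (suc L) ≡⟨ cong (λ t → suc t % suc (suc L)) (toℕ-inject₁ i) ⟩
  suc (toℕ i) % suc (suc L)           ≡⟨ m<n⇒m%n≡m (s≤s (toℕ<n i)) ⟩
  suc (toℕ i)                             ∎)

next-fromℕ : ∀ L → next (fromℕ L) ≡ zero
next-fromℕ L = toℕ-injective (trans (toℕ-next (fromℕ L))
  (trans (cong (λ t → suc t % suc L) (toℕ-fromℕ L)) (n%n≡0 (suc L))))

next-surjective : ∀ {L} (k : Fin L) → ∃ λ j → next j ≡ k
next-surjective {suc L} zero    = fromℕ L , next-fromℕ L
next-surjective {suc L} (suc i) = inject₁ i , next-inject₁ i

next-invariant⇒constant : ∀ {L} {B : Set} (g : Fin L → B) →
                          (∀ k → g (next k) ≡ g k) → ∀ k l → g k ≡ g l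
next-invariant⇒constant {suc L} g invariant k l = trans (from-zero k) (sym (from-zero l))
  where
  from-zero : ∀ k → g k ≡ g zero
  from-zero = <-weakInduction (λ k → g k ≡ g zero) refl λ i gi≡g0 →
    trans (cong g (sym (next-inject₁ i))) (trans (invariant (inject₁ i)) gi≡g0)

opposite : ∀ {n} → HalfEdge n → HalfEdge n
opposite h = vtx h , opp (slot h)

opposite-involutive : ∀ {n} (h : HalfEdge n) → opposite (opposite h) ≡ h
opposite-involutive h = ×-≡,≡→≡ (refl , opp-involutive (slot h))

module _ {n} {Γ : FramedGraph n} (C : RotatingCircuit Γ) where
  open RotatingCircuit C

  dep≢arr : ∀ k l → dep k ≢ arr l
  dep≢arr k l dep≡arr with once {inj₁ k} {inj₂ l} dep≡arr
  ... | ()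

  turn-changes-slot : ∀ k → slot (dep (next k)) ≢ slot (arr k)
  turn-changes-slot k same-slot = dep≢arr (next k) k (×-≡,≡→≡ (cont k , same-slot))

  sourceTarget⇒chordsPositive : SourceTarget Γ → AllChordsPositive C
  sourceTarget⇒chordsPositive (out , out-ι , alternating) k l k≢l same-vertex =
    alternating-equal⇒opposite (out at vtx (arr k)) (alternating (vtx (arr k))) slots-differ arrivals-agree
    where
    departure-step : ∀ k → out (dep (next k)) ≡ out (dep k)
    departure-step k = begin
      out (dep (next k))                         ≡⟨ cong (λ w → out (w , slot (dep (next k)))) (cont k) ⟩
      (out at vtx (arr k)) (slot (dep (next k))) ≡⟨ alternating-neighbour (out at vtx (arr k))
                                                      (alternating (vtx (arr k))) (turn-changes-slot k) (turn k) ⟩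
      not (out (arr k))                          ≡⟨ cong not (out-ι (dep k)) ⟩
      not (not (out (dep k)))                    ≡⟨ not-involutive _ ⟩
      out (dep k)                                ∎
    slots-differ : slot (arr l) ≢ slot (arr k)
    slots-differ same-slot with once {inj₂ l} {inj₂ k} (×-≡,≡→≡ (sym same-vertex , same-slot))
    ... | refl = k≢l refl
    arrivals-agree : (out at vtx (arr k)) (slot (arr l)) ≡ (out at vtx (arr k)) (slot (arr k))
    arrivals-agree = begin
      out (vtx (arr k) , slot (arr l)) ≡⟨ cong (λ w → out (w , slot (arr l))) same-vertex ⟩
      out (arr l)                      ≡⟨ out-ι (dep l) ⟩
      not (out (dep l))                ≡⟨ cong not (next-invariant⇒constant (out ∘ dep) departure-step l k) ⟩
      not (out (dep k))                ≡⟨ out-ι (dep k) ⟨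
      out (arr k)                      ∎

  side : Fin (2 * n) ⊎ Fin (2 * n) → Bool
  side = [ const true , const false ]

  outgoing : HalfEdge n → Bool
  outgoing h = side (proj₁ (covers h))

  outgoing-traversal : ∀ x → outgoing ([ dep , arr ] x) ≡ side x
  outgoing-traversal x = let y , y↦ = covers ([ dep , arr ] x) in cong side (once {y} {x} y↦)

  outgoing-dep : ∀ k → outgoing (dep k) ≡ true
  outgoing-dep k = outgoing-traversal (inj₁ k)

  outgoing-arr : ∀ k → outgoing (arr k) ≡ false
  outgoing-arr k = outgoing-traversal (inj₂ k)

  departure-or-arrival : (P : HalfEdge n → Set) → (∀ k → P (dep k)) → (∀ k → P (arr k)) → ∀ h → P h
  departure-or-arrival P on-dep on-arr h with covers h
  ... | inj₁ k , refl = on-dep k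
  ... | inj₂ k , refl = on-arr k

  outgoing-ι : ∀ h → outgoing (ι Γ h) ≡ not (outgoing h)
  outgoing-ι = departure-or-arrival (λ h → outgoing (ι Γ h) ≡ not (outgoing h))
    (λ k → trans (outgoing-arr k) (cong not (sym (outgoing-dep k))))
    (λ k → trans (cong outgoing (invol Γ (dep k))) (trans (outgoing-dep k) (cong not (sym (outgoing-arr k)))))

  incoming⇒arrival : ∀ h → outgoing h ≡ false → ∃ λ k → arr k ≡ h
  incoming⇒arrival = departure-or-arrival (λ h → outgoing h ≡ false → ∃ λ k → arr k ≡ h)
    (λ k incoming → ⊥-elim (not-¬ (outgoing-dep k) incoming)) (λ k _ → k , refl)

  reversed-at-vertex : ∀ h → ∃ λ h′ → vtx h′ ≡ vtx h × outgoing h′ ≡ not (outgoing h)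
  reversed-at-vertex = departure-or-arrival (λ h → ∃ λ h′ → vtx h′ ≡ vtx h × outgoing h′ ≡ not (outgoing h))
    at-departure
    (λ k → dep (next k) , cont k , trans (outgoing-dep (next k)) (cong not (sym (outgoing-arr k))))
    where
    at-departure : ∀ m → ∃ λ h′ → vtx h′ ≡ vtx (dep m) × outgoing h′ ≡ not (outgoing (dep m))
    at-departure m with next-surjective m
    ... | k , refl = arr k , sym (cont k) , trans (outgoing-arr k) (cong not (sym (outgoing-dep (next k))))

  module _ (positive : AllChordsPositive C) where

    departure-not-opposite-arrival : ∀ k m → dep m ≢ opposite (arr k)
    departure-not-opposite-arrival k m dep≡ with next-surjective m
    ... | k′ , refl with k′ ≟ k
    ...   | yes refl = turn k (cong slot dep≡)
    ...   | no  k′≢k = dep≢arr (next k′) k′ (sym (×-≡,≡→≡ (sym (cont k′) , arr-slot)))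
      where
      arr-slot : slot (arr k′) ≡ slot (dep (next k′))
      arr-slot = trans (positive k k′ (λ k≡k′ → k′≢k (sym k≡k′)) (trans (sym (cong vtx dep≡)) (cont k′)))
                       (sym (cong slot dep≡))

    incoming-opposite : ∀ h → outgoing h ≡ false → outgoing (opposite h) ≡ false
    incoming-opposite h incoming with incoming⇒arrival h incoming
    ... | k , refl = departure-or-arrival (λ h′ → h′ ≡ opposite (arr k) → outgoing h′ ≡ false)
      (λ m dep≡ → ⊥-elim (departure-not-opposite-arrival k m dep≡)) (λ l _ → outgoing-arr l) _ refl

    outgoing-opposite : ∀ h → outgoing (opposite h) ≡ outgoing h
    outgoing-opposite h with outgoing h in out-h
    ... | false = incoming-opposite h out-h
    ... | true  = ¬-not λ out-oh → not-¬ out-h (begin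
      outgoing h                       ≡⟨ cong outgoing (opposite-involutive h) ⟨
      outgoing (opposite (opposite h)) ≡⟨ incoming-opposite (opposite h) out-oh ⟩
      false                            ∎)

    chordsPositive⇒sourceTarget : SourceTarget Γ
    chordsPositive⇒sourceTarget = outgoing , outgoing-ι , λ v →
      let h′ , at-v , reversed = reversed-at-vertex (v , 0F) in
      opposite-invariant⇒alternating (outgoing at v) (λ i → outgoing-opposite (v , i))
        (trans (cong (λ w → outgoing (w , slot h′)) (sym at-v)) reversed)

-- Iterates, minimal periods and walks reversed by an involution

left-inverse⇒injective : ∀ {A B : Set} (f : A → B) (g : B → A) → (∀ x → g (f x) ≡ x) → Injective _≡_ _≡_ f
left-inverse⇒injective f g inverse {x} {y} same = trans (sym (inverse x)) (trans (cong g same) (inverse y))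

module _ {A : Set} where
  open import Function.Endo.Propositional A public using (_^_)
  open import Function.Endo.Propositional A using (^-homo)

  ^-+ : ∀ (f : A → A) m n x → (f ^ (m + n)) x ≡ (f ^ m) ((f ^ n) x)
  ^-+ f m n = cong-app (^-homo f m n)

  ^-comm : ∀ (f : A → A) m n x → (f ^ m) ((f ^ n) x) ≡ (f ^ n) ((f ^ m) x)
  ^-comm f m n x = trans (sym (^-+ f m n x)) (trans (cong (λ k → (f ^ k) x) (+-comm m n)) (^-+ f n m x))

  ^-suc : ∀ (f : A → A) k x → (f ^ suc k) x ≡ (f ^ k) (f x)
  ^-suc f k x = ^-comm f 1 k x

  ^-injective : ∀ {f : A → A} → Injective _≡_ _≡_ f → ∀ k → Injective _≡_ _≡_ (f ^ k)
  ^-injective f-injective zero    same = same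
  ^-injective f-injective (suc k) same = ^-injective f-injective k (f-injective same)

  ^-*-periodic : ∀ {f : A → A} {x m} → (f ^ m) x ≡ x → ∀ q → (f ^ (q * m)) x ≡ x
  ^-*-periodic periodic zero = refl
  ^-*-periodic {f} {x} {m} periodic (suc q) =
    trans (^-+ f m (q * m) x) (trans (cong (f ^ m) (^-*-periodic periodic q)) periodic)

  ^-% : ∀ {f : A → A} {x m} .{{_ : NonZero m}} → (f ^ m) x ≡ x → ∀ k → (f ^ k) x ≡ (f ^ (k % m)) x
  ^-% {f} {x} {m} periodic k = begin
    (f ^ k) x                              ≡⟨ cong (λ j → (f ^ j) x) (m≡m%n+[m/n]*n k m) ⟩
    (f ^ (k % m + (k / m) * m)) x          ≡⟨ ^-+ f (k % m) _ x ⟩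
    (f ^ (k % m)) ((f ^ ((k / m) * m)) x)  ≡⟨ cong (f ^ (k % m)) (^-*-periodic periodic (k / m)) ⟩
    (f ^ (k % m)) x                        ∎

  ^-next : ∀ {f : A → A} {x m} → (f ^ m) x ≡ x → ∀ (k : Fin m) → (f ^ toℕ (next k)) x ≡ f ((f ^ toℕ k) x)
  ^-next {f} {x} {suc m} periodic k =
    trans (cong (λ j → (f ^ j) x) (toℕ-next k)) (sym (^-% {f} {x} {suc m} periodic (suc (toℕ k))))

  ^-return : ∀ {f : A → A} {y P} → (f ^ suc P) y ≡ y → ∀ j → (f ^ (j * P)) ((f ^ j) y) ≡ y
  ^-return {f} {y} {P} periodic j = begin
    (f ^ (j * P)) ((f ^ j) y) ≡⟨ ^-+ f (j * P) j y ⟨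
    (f ^ (j * P + j)) y       ≡⟨ cong (λ k → (f ^ k) y) (trans (+-comm (j * P) j) (sym (*-suc j P))) ⟩
    (f ^ (j * suc P)) y       ≡⟨ ^-*-periodic periodic j ⟩
    y                         ∎

  record MinimalPeriod (f : A → A) (x : A) (m : ℕ) : Set where
    field
      period>0 : 0 < m
      periodic : (f ^ m) x ≡ x
      minimal  : ∀ {k} → 0 < k → k < m → (f ^ k) x ≢ x

  module _ {f : A → A} (f-injective : Injective _≡_ _≡_ f) where

    ^-repeat : ∀ {i j x} → i ≤ j → (f ^ i) x ≡ (f ^ j) x → (f ^ (j ∸ i)) x ≡ x
    ^-repeat {i} {j} {x} i≤j repeat = ^-injective f-injective i (begin
      (f ^ i) ((f ^ (j ∸ i)) x)  ≡⟨ ^-comm f i (j ∸ i) x ⟩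
      (f ^ (j ∸ i)) ((f ^ i) x)  ≡⟨ ^-+ f (j ∸ i) i x ⟨
      (f ^ (j ∸ i + i)) x        ≡⟨ cong (λ k → (f ^ k) x) (m∸n+n≡m i≤j) ⟩
      (f ^ j) x                  ≡⟨ repeat ⟨
      (f ^ i) x                  ∎)

    period-distinct : ∀ {x m i j} → MinimalPeriod f x m → i < j → j < m → (f ^ i) x ≢ (f ^ j) x
    period-distinct {i = i} {j} period i<j j<m repeat = MinimalPeriod.minimal period
      (m<n⇒0<n∸m i<j) (≤-<-trans (m∸n≤m j i) j<m) (^-repeat (<⇒≤ i<j) repeat)

    period-injective : ∀ {x m i j} → MinimalPeriod f x m → i < m → j < m → (f ^ i) x ≡ (f ^ j) x → i ≡ j
    period-injective {i = i} {j} period i<m j<m same with <-cmp i j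
    ... | tri< i<j _ _ = ⊥-elim (period-distinct period i<j j<m same)
    ... | tri≈ _ i≡j _ = i≡j
    ... | tri> _ _ j<i = ⊥-elim (period-distinct period j<i i<m (sym same))

    minimalPeriod-^ : ∀ {x m} → MinimalPeriod f x m → ∀ r → MinimalPeriod f ((f ^ r) x) m
    minimalPeriod-^ {x} {m} period r = record
      { period>0 = period>0
      ; periodic = trans (^-comm f m r x) (cong (f ^ r) periodic)
      ; minimal  = λ {k} k>0 k<m returns →
          minimal k>0 k<m (^-injective f-injective r (trans (^-comm f r k x) returns))
      }
      where open MinimalPeriod period

  module _ {N} (enumeration : Fin N ↔ A) where
    open Inverse enumeration using (to; from; strictlyInverseˡ)

    from-injective : Injective _≡_ _≡_ from
    from-injective = left-inverse⇒injective from to strictlyInverseˡ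

    _≟ᴬ_ : DecidableEquality A
    x ≟ᴬ y = map′ from-injective (cong from) (from x ≟ from y)

    periodic-point : ∀ {f : A → A} → Injective _≡_ _≡_ f → ∀ x → ∃ λ P → 0 < P × (f ^ P) x ≡ x
    periodic-point {f} f-injective x with pigeonhole (n<1+n N) (λ k → from ((f ^ toℕ k) x))
    ... | i , j , i<j , same =
      toℕ j ∸ toℕ i , m<n⇒0<n∸m i<j , ^-repeat f-injective (<⇒≤ i<j) (from-injective same)

    minimalPeriod : ∀ {f : A → A} → Injective _≡_ _≡_ f → ∀ x → ∃ (MinimalPeriod f x)
    minimalPeriod {f} f-injective x with periodic-point f-injective x
    ... | suc q , _ , periodic =
      first-return (¬∀⟶∃¬-smallest (suc q) Away (λ i → ¬? ((f ^ suc (toℕ i)) x ≟ᴬ x)) never)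
      where
      Away : Fin (suc q) → Set
      Away i = (f ^ suc (toℕ i)) x ≢ x
      never : ¬ (∀ i → Away i)
      never away = away (fromℕ q) (subst (λ k → (f ^ suc k) x ≡ x) (sym (toℕ-fromℕ q)) periodic)
      first-return : (∃ λ i → ¬ Away i × ((j : Fin′ i) → Away (inject j))) → ∃ (MinimalPeriod f x)
      first-return (i , ¬away , earlier) = suc (toℕ i) , record
        { period>0 = s≤s z≤n
        ; periodic = decidable-stable ((f ^ suc (toℕ i)) x ≟ᴬ x) ¬away
        ; minimal  = λ { {suc k} _ (s≤s k<i) → subst (λ j → (f ^ suc j) x ≢ x)
                           (trans (toℕ-inject (fromℕ< k<i)) (toℕ-fromℕ< k<i)) (earlier (fromℕ< k<i)) }
        }

  merge-cycles : ∀ {f g : A → A} {c d m P} → MinimalPeriod f c (suc m) →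
                 (∀ i j → (f ^ i) c ≢ (f ^ j) d) →
                 (∀ {i} → i < m → g ((f ^ i) c) ≡ f ((f ^ i) c)) → g ((f ^ m) c) ≡ d →
                 (∀ {j} → j < P → g ((f ^ j) d) ≡ f ((f ^ j) d)) → g ((f ^ P) d) ≡ c →
                 MinimalPeriod g c (suc m + suc P)
  merge-cycles {f} {g} {c} {d} {m} {P} c-period disjoint agree-c c→d agree-d d→c = record
    { period>0 = s≤s z≤n
    ; periodic = trans (cong (λ k → (g ^ k) c) (+-suc (suc m) P)) (trans (cong g (along-d ≤-refl)) d→c)
    ; minimal  = minimal
    }
    where
    along-c : ∀ {i} → i ≤ m → (g ^ i) c ≡ (f ^ i) c
    along-c {zero}  _     = refl
    along-c {suc i} i+1≤m = trans (cong g (along-c (<⇒≤ i+1≤m))) (agree-c i+1≤m)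

    along-d : ∀ {j} → j ≤ P → (g ^ (suc m + j)) c ≡ (f ^ j) d
    along-d {zero}  _     = trans (cong (λ k → (g ^ k) c) (+-identityʳ (suc m)))
                                  (trans (cong g (along-c ≤-refl)) c→d)
    along-d {suc j} j+1≤P = trans (cong (λ k → (g ^ k) c) (+-suc (suc m) j))
                                  (trans (cong g (along-d (<⇒≤ j+1≤P))) (agree-d j+1≤P))

    minimal : ∀ {k} → 0 < k → k < suc m + suc P → (g ^ k) c ≢ c
    minimal {k} k>0 k<length returns with k ≤? m
    ... | yes k≤m = MinimalPeriod.minimal c-period k>0 (s≤s k≤m) (trans (sym (along-c k≤m)) returns)
    ... | no  k≰m = disjoint 0 (k ∸ suc m) (begin
      c                             ≡⟨ returns ⟨
      (g ^ k) c                     ≡⟨ cong (λ t → (g ^ t) c) k≡ ⟨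
      (g ^ (suc m + (k ∸ suc m))) c ≡⟨ along-d (m<1+n⇒m≤n (+-cancelˡ-< (suc m) _ _ k<length′)) ⟩
      (f ^ (k ∸ suc m)) d           ∎)
      where
      k≡ : suc m + (k ∸ suc m) ≡ k
      k≡ = m+[n∸m]≡n (≰⇒> k≰m)
      k<length′ : suc m + (k ∸ suc m) < suc m + suc P
      k<length′ = subst (_< suc m + suc P) (sym k≡) k<length

module Reversal {A : Set} (ι p : A → A)
                (ι-involutive : ∀ h → ι (ι h) ≡ h) (ι-fixpoint-free : ∀ h → ι h ≢ h)
                (p-involutive : ∀ h → p (p h) ≡ h) (p-fixpoint-free : ∀ h → p h ≢ h) where

  advance : A → A
  advance h = p (ι h)

  advance-injective : Injective _≡_ _≡_ advance
  advance-injective = left-inverse⇒injective ι ι ι-involutive ∘ left-inverse⇒injective p p p-involutive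

  advance-ι-advance : ∀ h → advance (ι (advance h)) ≡ ι h
  advance-ι-advance h = trans (cong p (ι-involutive (p (ι h)))) (p-involutive (ι h))

  ^-ι-^ : ∀ k h → (advance ^ k) (ι ((advance ^ k) h)) ≡ ι h
  ^-ι-^ zero    h = refl
  ^-ι-^ (suc k) h = begin
    (advance ^ suc k) (ι (advance ((advance ^ k) h)))       ≡⟨ ^-suc advance k _ ⟩
    (advance ^ k) (advance (ι (advance ((advance ^ k) h)))) ≡⟨ cong (advance ^ k) (advance-ι-advance _) ⟩
    (advance ^ k) (ι ((advance ^ k) h))                     ≡⟨ ^-ι-^ k h ⟩
    ι h                                                     ∎

  orbit-avoids-ι : ∀ k h → (advance ^ k) h ≢ ι h
  orbit-avoids-ι zero          h same = ι-fixpoint-free h (sym same)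
  orbit-avoids-ι (suc zero)    h same = p-fixpoint-free (ι h) same
  orbit-avoids-ι (suc (suc k)) h same = orbit-avoids-ι k (advance h) (advance-injective (begin
    advance ((advance ^ k) (advance h)) ≡⟨ cong advance (^-suc advance k h) ⟨
    (advance ^ suc (suc k)) h           ≡⟨ same ⟩
    ι h                                 ≡⟨ advance-ι-advance h ⟨
    advance (ι (advance h))             ∎))

  orbit-ι-disjoint : ∀ i j h → (advance ^ i) h ≢ ι ((advance ^ j) h)
  orbit-ι-disjoint i j h same = orbit-avoids-ι (j + i) h (begin
    (advance ^ (j + i)) h                     ≡⟨ ^-+ advance j i h ⟩
    (advance ^ j) ((advance ^ i) h)           ≡⟨ cong (advance ^ j) same ⟩
    (advance ^ j) (ι ((advance ^ j) h))       ≡⟨ ^-ι-^ j h ⟩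
    ι h                                       ∎)

  module Traversal {s m} (period : MinimalPeriod advance s m) where
    open MinimalPeriod period

    departure : Fin m → A
    departure k = (advance ^ toℕ k) s

    traversal : Fin m ⊎ Fin m → A
    traversal = [ departure , (λ k → ι (departure k)) ]

    departure-next : ∀ k → departure (next k) ≡ advance (departure k)
    departure-next = ^-next periodic

    departure-injective : Injective _≡_ _≡_ departure
    departure-injective {k} {l} same =
      toℕ-injective (period-injective advance-injective period (toℕ<n k) (toℕ<n l) same)

    traversal-injective : Injective _≡_ _≡_ traversal
    traversal-injective {inj₁ k} {inj₁ l} same = cong inj₁ (departure-injective same)
    traversal-injective {inj₁ k} {inj₂ l} same = ⊥-elim (orbit-ι-disjoint (toℕ k) (toℕ l) s same)
    traversal-injective {inj₂ k} {inj₁ l} same = ⊥-elim (orbit-ι-disjoint (toℕ l) (toℕ k) s (sym same))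
    traversal-injective {inj₂ k} {inj₂ l} same =
      cong inj₂ (departure-injective (left-inverse⇒injective ι ι ι-involutive same))

    OnCircuit : A → Set
    OnCircuit h = ∃ λ x → traversal x ≡ h

    start-onCircuit : OnCircuit s
    start-onCircuit = inj₁ (fromℕ< period>0) , cong (λ k → (advance ^ k) s) (toℕ-fromℕ< period>0)

    onCircuit-ι : ∀ {h} → OnCircuit h → OnCircuit (ι h)
    onCircuit-ι (inj₁ k , refl) = inj₂ k , refl
    onCircuit-ι (inj₂ k , refl) = inj₁ k , sym (ι-involutive (departure k))

    onCircuit-advance : ∀ {h} → OnCircuit h → OnCircuit (advance h)
    onCircuit-advance (inj₁ k , refl) = inj₁ (next k) , departure-next k
    onCircuit-advance (inj₂ k , refl) with next-surjective k
    ... | j , refl = inj₂ j , sym (trans (cong (advance ∘ ι) (departure-next j)) (advance-ι-advance (departure j)))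

    onCircuit-^ : ∀ k {h} → OnCircuit h → OnCircuit ((advance ^ k) h)
    onCircuit-^ zero    on = on
    onCircuit-^ (suc k) on = onCircuit-advance (onCircuit-^ k on)

    onCircuit-p : ∀ {h} → OnCircuit h → OnCircuit (p h)
    onCircuit-p {h} on = subst OnCircuit (cong p (ι-involutive h)) (onCircuit-advance (onCircuit-ι on))

    onCircuit? : DecidableEquality A → ∀ h → Dec (OnCircuit h)
    onCircuit? _≟ₐ_ h = map′ merge split
      (any? (λ k → traversal (inj₁ k) ≟ₐ h) ⊎-dec any? (λ k → traversal (inj₂ k) ≟ₐ h))
      where
      merge : (∃ λ k → traversal (inj₁ k) ≡ h) ⊎ (∃ λ k → traversal (inj₂ k) ≡ h) → OnCircuit h
      merge (inj₁ (k , on)) = inj₁ k , on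
      merge (inj₂ (k , on)) = inj₂ k , on
      split : OnCircuit h → (∃ λ k → traversal (inj₁ k) ≡ h) ⊎ (∃ λ k → traversal (inj₂ k) ≡ h)
      split (inj₁ k , on) = inj₁ (k , on)
      split (inj₂ k , on) = inj₂ (k , on)

    module _ {N} (enumeration : Fin N ↔ A) where
      open Inverse enumeration using (to; from; strictlyInverseʳ)

      traversal-length : m + m ≤ N
      traversal-length = injective⇒≤ encode-injective
        where
        encode-injective : Injective _≡_ _≡_ (λ i → from (traversal (splitAt m i)))
        encode-injective same = left-inverse⇒injective (splitAt m) (join m m) (join-splitAt m m)
          (traversal-injective (from-injective enumeration same))

      covering-length : (∀ h → OnCircuit h) → m + m ≡ N
      covering-length covering = ≤-antisym traversal-length (injective⇒≤ position-injective)
        where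
        position : Fin N → Fin (m + m)
        position i = join m m (proj₁ (covering (to i)))
        position-injective : Injective _≡_ _≡_ position
        position-injective {i} {j} same = left-inverse⇒injective to from strictlyInverseʳ (begin
          to i                              ≡⟨ proj₂ (covering (to i)) ⟨
          traversal (proj₁ (covering (to i))) ≡⟨ cong traversal (left-inverse⇒injective (join m m) (splitAt m)
                                                   (splitAt-join m m) {proj₁ (covering (to i))} {proj₁ (covering (to j))} same) ⟩
          traversal (proj₁ (covering (to j))) ≡⟨ proj₂ (covering (to j)) ⟩
          to j                              ∎)

-- Existence of rotating circuits

-- The two pairings of the slots at a vertex into non-opposite pairs; a transition system
-- chooses one of them at every vertex.
τ : Bool → Fin 4 → Fin 4
τ false 0F = 1F
τ false 1F = 0F
τ false 2F = 3F
τ false 3F = 2F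
τ true  0F = 3F
τ true  1F = 2F
τ true  2F = 1F
τ true  3F = 0F

τ-involutive : ∀ b i → τ b (τ b i) ≡ i
τ-involutive false = from-yes (all? λ i → τ false (τ false i) ≟ i)
τ-involutive true  = from-yes (all? λ i → τ true (τ true i) ≟ i)

τ-fixpoint-free : ∀ b i → τ b i ≢ i
τ-fixpoint-free false = from-yes (all? λ i → ¬? (τ false i ≟ i))
τ-fixpoint-free true  = from-yes (all? λ i → ¬? (τ true i ≟ i))

τ-not-opposite : ∀ b i → τ b i ≢ opp i
τ-not-opposite false = from-yes (all? λ i → ¬? (τ false i ≟ opp i))
τ-not-opposite true  = from-yes (all? λ i → ¬? (τ true i ≟ opp i))

τ-exchange : ∀ b i → τ (not b) (τ b (τ (not b) i)) ≡ τ b i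
τ-exchange false = from-yes (all? λ i → τ true (τ false (τ true i)) ≟ τ false i)
τ-exchange true  = from-yes (all? λ i → τ false (τ true (τ false i)) ≟ τ true i)

τ-slots : ∀ b i j → j ≡ i ⊎ j ≡ τ b i ⊎ j ≡ τ (not b) i ⊎ j ≡ τ b (τ (not b) i)
τ-slots false = from-yes (all? λ i → all? λ j →
  j ≟ i ⊎-dec j ≟ τ false i ⊎-dec j ≟ τ true i ⊎-dec j ≟ τ false (τ true i))
τ-slots true  = from-yes (all? λ i → all? λ j →
  j ≟ i ⊎-dec j ≟ τ true i ⊎-dec j ≟ τ false i ⊎-dec j ≟ τ true (τ false i))

m+m≡n*4⇒m≡2*n : ∀ {m n} → m + m ≡ n * 4 → m ≡ 2 * n
m+m≡n*4⇒m≡2*n {m} {n} m+m≡ = *-cancelˡ-≡ m (2 * n) 2 (begin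
  2 * m         ≡⟨ cong (m +_) (+-identityʳ m) ⟩
  m + m         ≡⟨ m+m≡ ⟩
  n * 4         ≡⟨ *-comm n 4 ⟩
  4 * n         ≡⟨ *-assoc 2 2 n ⟩
  2 * (2 * n)   ∎)

halfEdges : ∀ {n} → Fin (n * 4) ↔ HalfEdge n
halfEdges = *↔×

module Transitions {n} (Γ : FramedGraph n) where

  pairing : (Fin n → Bool) → HalfEdge n → HalfEdge n
  pairing T h = vtx h , τ (T (vtx h)) (slot h)

  pairing-involutive : ∀ T h → pairing T (pairing T h) ≡ h
  pairing-involutive T h = cong (vtx h ,_) (τ-involutive (T (vtx h)) (slot h))

  module Walk (T : Fin n → Bool) = Reversal (ι Γ) (pairing T) (invol Γ) (noFix Γ)
    (pairing-involutive T) (λ h same → τ-fixpoint-free (T (vtx h)) (slot h) (cong slot same))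
  open Walk using (advance; advance-injective)

  record Circuit : Set where
    field
      transitions : Fin n → Bool
      start       : HalfEdge n
      length      : ℕ
      period      : MinimalPeriod (advance transitions) start length
    open Walk.Traversal transitions period public

  flip-at : Fin n → (Fin n → Bool) → Fin n → Bool
  flip-at v T w with w ≟ v
  ... | yes _ = not (T w)
  ... | no  _ = T w

  advance-flip-away : ∀ {T v h} → vtx (ι Γ h) ≢ v → advance (flip-at v T) h ≡ advance T h
  advance-flip-away {T} {v} {h} away with vtx (ι Γ h) ≟ v
  ... | yes at = ⊥-elim (away at)
  ... | no  _  = refl

  advance-flip-at : ∀ {T v h} → vtx (ι Γ h) ≡ v → advance (flip-at v T) h ≡ (v , τ (not (T v)) (slot (ι Γ h)))
  advance-flip-at {T} {h = h} refl with vtx (ι Γ h) ≟ vtx (ι Γ h)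
  ... | yes _     = refl
  ... | no  ¬refl = ⊥-elim (¬refl refl)

  -- The walk arrives at v along a and continues along c; flipping the pairing at v sends it to
  -- the unused half-edge y instead, around the whole (disjoint) closed walk through y, and back
  -- to c, so the two closed walks are spliced into one.
  module Extension (C : Circuit) (k₀ : ℕ) (j : Fin 4)
                   (off : ¬ Circuit.OnCircuit C
                                (vtx (ι Γ ((advance (Circuit.transitions C) ^ k₀) (Circuit.start C))) , j))
                   where
    open Circuit C renaming (transitions to T; start to s; length to m)
    open Walk T using (orbit-ι-disjoint)

    f : HalfEdge n → HalfEdge n
    f = advance T

    x a c : HalfEdge n
    x = (f ^ k₀) s
    a = ι Γ x
    c = f x

    v : Fin n
    v = vtx a

    g : HalfEdge n → HalfEdge n
    g = advance (flip-at v T)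

    y : HalfEdge n
    y = v , τ (not (T v)) (slot a)

    g-x : g x ≡ y
    g-x = advance-flip-at refl

    at-v : ∀ h → vtx h ≡ v → h ≡ a ⊎ h ≡ c ⊎ h ≡ y ⊎ h ≡ pairing T y
    at-v h at with τ-slots (T v) (slot a) (slot h)
    ... | inj₁ e               = inj₁ (×-≡,≡→≡ (at , e))
    ... | inj₂ (inj₁ e)        = inj₂ (inj₁ (×-≡,≡→≡ (at , e)))
    ... | inj₂ (inj₂ (inj₁ e)) = inj₂ (inj₂ (inj₁ (×-≡,≡→≡ (at , e))))
    ... | inj₂ (inj₂ (inj₂ e)) = inj₂ (inj₂ (inj₂ (×-≡,≡→≡ (at , e))))

    on-a : OnCircuit a
    on-a = onCircuit-ι (onCircuit-^ k₀ start-onCircuit)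

    on-c : OnCircuit c
    on-c = onCircuit-advance (onCircuit-^ k₀ start-onCircuit)

    new-pair-off : ¬ OnCircuit y × ¬ OnCircuit (pairing T y)
    new-pair-off with at-v (v , j) refl
    ... | inj₁ u≡a               = ⊥-elim (off (subst OnCircuit (sym u≡a) on-a))
    ... | inj₂ (inj₁ u≡c)        = ⊥-elim (off (subst OnCircuit (sym u≡c) on-c))
    ... | inj₂ (inj₂ (inj₁ u≡y)) =
      (λ on → off (subst OnCircuit (sym u≡y) on)) ,
      (λ on → off (subst OnCircuit (trans (pairing-involutive T y) (sym u≡y)) (onCircuit-p on)))
    ... | inj₂ (inj₂ (inj₂ u≡py)) =
      (λ on → off (subst OnCircuit (sym u≡py) (onCircuit-p on))) ,
      (λ on → off (subst OnCircuit (sym u≡py) on))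

    agree : ∀ h → ι Γ h ≢ a → ι Γ h ≢ c → ι Γ h ≢ y → ι Γ h ≢ pairing T y → g h ≡ f h
    agree h ≢a ≢c ≢y ≢py = by-vertex (vtx (ι Γ h) ≟ v)
      where
      by-vertex : Dec (vtx (ι Γ h) ≡ v) → g h ≡ f h
      by-vertex (no  away) = advance-flip-away away
      by-vertex (yes at)   = ⊥-elim ([ ≢a , [ ≢c , [ ≢y , ≢py ] ] ] (at-v (ι Γ h) at))

    module Merge {m′ P} (c-period : MinimalPeriod f c (suc m′)) (y-period : MinimalPeriod f y (suc P)) where

      c-last : (f ^ m′) c ≡ x
      c-last = advance-injective T (MinimalPeriod.periodic c-period)

      y-last : ι Γ ((f ^ P) y) ≡ pairing T y
      y-last = trans (sym (pairing-involutive T _)) (cong (pairing T) (MinimalPeriod.periodic y-period))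

      c-orbit-on : ∀ i → OnCircuit ((f ^ i) c)
      c-orbit-on i = onCircuit-^ i on-c

      y-orbit-off : ∀ j → ¬ OnCircuit ((f ^ j) y)
      y-orbit-off j on = proj₁ new-pair-off
        (subst OnCircuit (^-return (MinimalPeriod.periodic y-period) j) (onCircuit-^ (j * P) on))

      y-orbit-ι-off : ∀ j → ¬ OnCircuit (ι Γ ((f ^ j) y))
      y-orbit-ι-off j on = y-orbit-off j (subst OnCircuit (invol Γ _) (onCircuit-ι on))

      agree-c : ∀ {i} → i < m′ → g ((f ^ i) c) ≡ f ((f ^ i) c)
      agree-c {i} i<m′ = agree ((f ^ i) c)
        (λ e → <-irrefl (period-injective (advance-injective T) c-period (m<n⇒m<1+n i<m′) ≤-refl
                          (trans (left-inverse⇒injective (ι Γ) (ι Γ) (invol Γ) e) (sym c-last))) i<m′)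
        (λ e → orbit-ι-disjoint 0 i c (sym e))
        (λ e → proj₁ new-pair-off (subst OnCircuit e (onCircuit-ι (c-orbit-on i))))
        (λ e → proj₂ new-pair-off (subst OnCircuit e (onCircuit-ι (c-orbit-on i))))

      agree-y : ∀ {j} → j < P → g ((f ^ j) y) ≡ f ((f ^ j) y)
      agree-y {j} j<P = agree ((f ^ j) y)
        (λ e → y-orbit-ι-off j (subst OnCircuit (sym e) on-a))
        (λ e → y-orbit-ι-off j (subst OnCircuit (sym e) on-c))
        (λ e → orbit-ι-disjoint 0 j y (sym e))
        (λ e → <-irrefl (period-injective (advance-injective T) y-period (m<n⇒m<1+n j<P) ≤-refl
                          (left-inverse⇒injective (ι Γ) (ι Γ) (invol Γ) (trans e (sym y-last)))) j<P)

      y→c : g ((f ^ P) y) ≡ c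
      y→c = begin
        g ((f ^ P) y)                                 ≡⟨ advance-flip-at (cong vtx y-last) ⟩
        v , τ (not (T v)) (slot (ι Γ ((f ^ P) y)))    ≡⟨ cong (λ h → v , τ (not (T v)) (slot h)) y-last ⟩
        v , τ (not (T v)) (τ (T v) (slot y))          ≡⟨ cong (v ,_) (τ-exchange (T v) (slot a)) ⟩
        c                                             ∎

      merged : MinimalPeriod g c (suc m′ + suc P)
      merged = merge-cycles c-period
        (λ i j same → y-orbit-off j (subst OnCircuit same (c-orbit-on i)))
        agree-c (trans (cong g c-last) g-x) agree-y y→c

    longer-circuit : ∃ λ (C′ : Circuit) → m < Circuit.length C′
    longer-circuit = splice (minimalPeriod-^ (advance-injective T) period (suc k₀))
                            (minimalPeriod halfEdges (advance-injective T) y)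
      where
      splice : ∀ {m} → MinimalPeriod f c m → ∃ (MinimalPeriod f y) → ∃ λ (C′ : Circuit) → m < Circuit.length C′
      splice {suc m′} c-period (suc P , y-period) =
        record { transitions = flip-at v T ; start = c ; length = suc m′ + suc P
               ; period = Merge.merged c-period y-period } ,
        m<m+n (suc m′) (s≤s z≤n)

  arrival-at : ∀ {T s m} (period : MinimalPeriod (advance T) s m) {h} → Walk.Traversal.OnCircuit T period h →
               ∃ λ k → vtx (ι Γ ((advance T ^ k) s)) ≡ vtx h
  arrival-at {T} period (inj₂ k , refl) = toℕ k , refl
  arrival-at {T} period (inj₁ k , refl) with next-surjective k
  ... | j , refl = toℕ j , sym (cong vtx (Walk.Traversal.departure-next T period j))

  mixed-vertex : (P : HalfEdge n → Set) → (∀ h → Dec (P h)) → (∀ {h} → P h → P (ι Γ h)) →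
                 ∀ {u w} → Reach Γ u w → (∃ λ i → P (u , i)) → (∃ λ j → ¬ P (w , j)) →
                 ∃ λ v → (∃ λ i → P (v , i)) × (∃ λ j → ¬ P (v , j))
  mixed-vertex P P? P-ι here        on off = _ , on , off
  mixed-vertex P P? P-ι {u} (step i path) on off with all? (λ k → P? (u , k))
  ... | yes all-on = mixed-vertex P P? P-ι path (_ , P-ι (all-on i)) off
  ... | no  ¬all   = u , on , ¬∀⟶∃¬ 4 _ (λ k → P? (u , k)) ¬all

  extend : (C : Circuit) → ∀ {v} → (∃ λ i → Circuit.OnCircuit C (v , i)) →
           (∃ λ j → ¬ Circuit.OnCircuit C (v , j)) → ∃ λ (C′ : Circuit) → Circuit.length C < Circuit.length C′
  extend C (i , on) (j , off) with arrival-at {Circuit.transitions C} (Circuit.period C) on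
  ... | k₀ , refl = Extension.longer-circuit C k₀ j off

  Covering : Circuit → Set
  Covering C = ∀ h → Circuit.OnCircuit C h

  covering-circuit : (∀ u w → Reach Γ u w) → HalfEdge n → Σ Circuit Covering
  covering-circuit reach h₀ = grow (n * 4) initial (m≤n+m (n * 4) _)
    where
    open Inverse halfEdges using (to; from; strictlyInverseˡ)

    initial : Circuit
    initial = record
      { transitions = const false
      ; start       = h₀
      ; length      = proj₁ (minimalPeriod halfEdges (advance-injective (const false)) h₀)
      ; period      = proj₂ (minimalPeriod halfEdges (advance-injective (const false)) h₀)
      }

    -- Each extension lengthens the walk, whose length stays at most half the number of
    -- half-edges (traversal-length), so n * 4 extensions are more than enough.
    grow : ∀ fuel (C : Circuit) → n * 4 ≤ Circuit.length C + fuel → Σ Circuit Covering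
    grow zero C bound = ⊥-elim (n≮0 (<-≤-trans (MinimalPeriod.period>0 period)
      (+-cancelˡ-≤ length length 0 (≤-trans (traversal-length halfEdges) bound))))
      where open Circuit C
    grow (suc fuel) C bound = continue (all? λ i → on? (to i))
      where
      open Circuit C
      on? : ∀ h → Dec (OnCircuit h)
      on? = onCircuit? (_≟ᴬ_ halfEdges)
      continue : Dec (∀ i → OnCircuit (to i)) → Σ Circuit Covering
      continue (yes all-on) = C , λ h → subst OnCircuit (strictlyInverseˡ h) (all-on (from h))
      continue (no ¬all-on) with ¬∀⟶∃¬ (n * 4) _ (λ i → on? (to i)) ¬all-on
      ... | i , off with mixed-vertex OnCircuit on? onCircuit-ι (reach (vtx start) _) (_ , start-onCircuit) (_ , off)
      ... | _ , on , off′ with extend C on off′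
      ... | C′ , longer =
        grow fuel C′ (≤-trans bound (≤-trans (≤-reflexive (+-suc _ fuel)) (+-monoˡ-≤ fuel longer)))

  rotatingCircuit-of-length : ∀ {T s} (period : MinimalPeriod (advance T) s (2 * n)) →
                              (∀ h → Walk.Traversal.OnCircuit T period h) → RotatingCircuit Γ
  rotatingCircuit-of-length {T} period covering = record
    { dep    = departure
    ; cont   = λ k → cong vtx (departure-next k)
    ; turn   = λ k same → τ-not-opposite _ _ (trans (sym (cong slot (departure-next k))) same)
    ; once   = traversal-injective
    ; covers = covering
    }
    where open Walk.Traversal T period

  covering⇒rotatingCircuit : Σ Circuit Covering → RotatingCircuit Γ
  covering⇒rotatingCircuit (C , covering) = of-length period covering (covering-length halfEdges covering)
    where
    open Circuit C
    of-length : ∀ {m} (period : MinimalPeriod (advance transitions) start m) →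
                (∀ h → Walk.Traversal.OnCircuit transitions period h) → m + m ≡ n * 4 → RotatingCircuit Γ
    of-length {m} period covering m+m≡ with m+m≡n*4⇒m≡2*n {m} {n} m+m≡
    ... | refl = rotatingCircuit-of-length {transitions} period covering

rotatingCircuit-exists : ∀ {n} {Γ : FramedGraph n} → Connected Γ → RotatingCircuit Γ
rotatingCircuit-exists {suc n} {Γ} (_ , reach) = covering⇒rotatingCircuit (covering-circuit reach (zero , zero))
  where open Transitions Γ

mainTheorem2 : ∀ {n : ℕ} (Γ : FramedGraph n) → Connected Γ →
    (SourceTarget Γ ⇔ CheckerboardEmbedding Γ) ×
    (SourceTarget Γ ⇔ ((C : RotatingCircuit Γ) → AllChordsPositive C))
mainTheorem2 Γ connected =
  mk⇔ sourceTarget⇒embedding embedding⇒sourceTarget ,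
  mk⇔ (λ sourceTarget C → sourceTarget⇒chordsPositive C sourceTarget)
      (λ positive → chordsPositive⇒sourceTarget circuit (positive circuit))
  where
  circuit : RotatingCircuit Γ
  circuit = rotatingCircuit-exists connected
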